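{- Let $p$ be an odd prime, let $P$ be a Hurwitz prime of norm $p$, and let $\Pi$ be the image of the left ideal $\mathcal{H}P$ in $\overline{\mathcal{H}} = \mathcal{H}/p\mathcal{H}$. Then $\Pi$ is a two-dimensional $\mathbb{F}_p$-subspace, and there is a nonzero element of $\Pi$ of trace zero, i.e. of the form $xi+yj+zk$ with $x,y,z \in \mathbb{F}_p$, and it is unique up to scaling by $\mathbb{F}_p^\times$.
   Context: $\mathcal{H}$ is the ring of Hurwitz integers: quaternions $a+bi+cj+dk$ with $a,b,c,d$ all in $\mathbb{Z}$ or all in $\mathbb{Z}+1/2$. Norm: $\mathrm{N}(a+bi+cj+dk)=a^2+b^2+c^2+d^2$; trace: $\operatorname{tr}(a+bi+cj+dk)=2a$. A Hurwitz prime is an irreducible element of $\mathcal{H}$. For odd $p$, $\overline{\mathcal{H}}=\mathcal{H}/p\mathcal{H}$ is a four-dimensional $\mathbb{F}_p$-algebra with basis $1,i,j,k$, and the trace induces an $\mathbb{F}_p$-linear functional $a+bi+cj+dk \mapsto 2a$ on it. -}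

module Defs where

open import Data.Nat using (ℕ)
open import Data.Integer using (ℤ; +_; _+_; _-_; _*_; -_)
open import Data.Integer.DivMod using (_/ℕ_)
open import Data.Integer.Divisibility using (_∣_)
open import Data.Product using (Σ; _×_; _,_; ∃)
open import Data.Sum using (_⊎_)
open import Relation.Nullary using (¬_)
open import Relation.Binary.PropositionalEquality using (_≡_)

-- A Hurwitz integer  α = (a + b i + c j + d k)/2  is stored by its
-- DOUBLED coordinates (a , b , c , d) ∈ ℤ⁴, which must all have the same
-- parity (all even  <->  α ∈ ℤ⟨i,j,k⟩ ;  all odd  <->  half-integer case).

record Q4 : Set where
  constructor q4
  field
    re im-i im-j im-k : ℤ
open Q4 public

_·_ : Q4 → Q4 → Q4
q4 a₁ b₁ c₁ d₁ · q4 a₂ b₂ c₂ d₂ = q4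
  (a₁ * a₂ - b₁ * b₂ - c₁ * c₂ - d₁ * d₂)
  (a₁ * b₂ + b₁ * a₂ + c₁ * d₂ - d₁ * c₂)
  (a₁ * c₂ - b₁ * d₂ + c₁ * a₂ + d₁ * b₂)
  (a₁ * d₂ + b₁ * c₂ - c₁ * b₂ + d₁ * a₂)

IsHurwitz : Q4 → Set
IsHurwitz (q4 a b c d) = (+ 2 ∣ (a - b)) × (+ 2 ∣ (b - c)) × (+ 2 ∣ (c - d))

-- Hurwitz multiplication in doubled coordinates:
-- (A/2)(B/2) = (A·B)/4, whose doubled coordinates are (A·B)/2
-- (the division is exact for Hurwitz integers).
half : Q4 → Q4
half (q4 a b c d) = q4 (a /ℕ 2) (b /ℕ 2) (c /ℕ 2) (d /ℕ 2)

_⊗_ : Q4 → Q4 → Q4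
A ⊗ B = half (A · B)

oneH : Q4
oneH = q4 (+ 2) (+ 0) (+ 0) (+ 0)

-- Norm  N(α) = a²+b²+c²+d²  of α = (A/2);  in doubled coordinates
-- this is (A₀²+A₁²+A₂²+A₃²)/4  (exact for Hurwitz integers).
normH : Q4 → ℤ
normH (q4 a b c d) = (a * a + b * b + c * c + d * d) /ℕ 4

IsUnit : Q4 → Set
IsUnit U = Σ Q4 λ V → IsHurwitz V × (U ⊗ V ≡ oneH) × (V ⊗ U ≡ oneH)

IsHurwitzPrime : Q4 → Set
IsHurwitzPrime P =
  ¬ (P ≡ q4 (+ 0) (+ 0) (+ 0) (+ 0)) × ¬ IsUnit P ×
  (∀ Q R → IsHurwitz Q → IsHurwitz R → P ≡ Q ⊗ R → IsUnit Q ⊎ IsUnit R)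

-- Elements of 𝔽_p are represented by integers, with equality being
-- congruence mod p; an element of ℋ̄ is represented by a Q4 (its
-- coordinates w.r.t. 1,i,j,k), with coordinatewise congruence mod p.

infix 4 _≡[_]_ _≈[_]_
infixl 6 _⊕_
infixr 7 _•_
infixl 7 _·_ _⊗_

_≡[_]_ : ℤ → ℕ → ℤ → Set
x ≡[ p ] y = + p ∣ (x - y)

_≈[_]_ : Q4 → ℕ → Q4 → Set
q4 a b c d ≈[ p ] q4 a' b' c' d' =
  (a ≡[ p ] a') × (b ≡[ p ] b') × (c ≡[ p ] c') × (d ≡[ p ] d')

zeroQ : Q4
zeroQ = q4 (+ 0) (+ 0) (+ 0) (+ 0)

_•_ : ℤ → Q4 → Q4
s • q4 a b c d = q4 (s * a) (s * b) (s * c) (s * d)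

_⊕_ : Q4 → Q4 → Q4
q4 a b c d ⊕ q4 a' b' c' d' = q4 (a + a') (b + b') (c + c') (d + d')

-- reduction map ℋ → ℋ̄ :  x is the image of the Hurwitz integer with
-- doubled coordinates A  iff  x = A/2 in 𝔽_p⁴, i.e.  2·x ≡ A (mod p)
-- (2 is invertible in 𝔽_p since p is odd).
ReducesTo : ℕ → Q4 → Q4 → Set
ReducesTo p A x = ((+ 2) • x) ≈[ p ] A

InΠ : ℕ → Q4 → Q4 → Set
InΠ p P x = Σ Q4 λ h → IsHurwitz h × ReducesTo p (h ⊗ P) x

tr : Q4 → ℤ
tr x = + 2 * re x

{-# OPTIONS --safe #-}
-- Write P = (a + bi + cj + dk)/2 and N = a² + b² + c² + d² = 4p.  For an imaginary unit u with
-- β the u-coordinate of P and n = a² + β², put w = (β + au)P and v = (a − βu)P.  For every integer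
-- quaternion g, with y = gP and g⊥ the part of g orthogonal to 1 and u, a polynomial identity gives
--   n·y = y_u·w + y_0·v + N·g⊥(a + βu),
-- so modulo p every element of ℋP lies in span(w, v), and conversely w, v ∈ ℋP.  As re w = 0,
-- re v = n and the u-coordinate of w is n, for n ≢ 0 (mod p) the two are independent and w spans
-- the only trace-zero line.  Such an axis exists: if a² + b², a² + c² and a² + d² all vanished
-- mod p, so would 2a² = (their sum) − N, hence every coordinate, and p² would divide N = 4p.
module Submission where

open import Defs
open import Data.Nat using (ℕ)
open import Data.Nat.Primality using (Prime)
open import Data.Nat.Divisibility using (_∣_)
open import Data.Integer using (ℤ; +_)
open import Data.Product using (Σ; _×_; _,_)
open import Function.Bundles using (_⇔_)
open import Relation.Nullary using (¬_)
open import Relation.Binary.PropositionalEquality using (_≡_)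

open import Data.Empty using (⊥-elim)
open import Data.Integer using (-[1+_]; _+_; _-_; _*_; -_; ∣_∣; _≤_)
open import Data.Integer.DivMod using (_/ℕ_; [n/ℕd]*d≤n; n<s[n/ℕd]*d)
open import Data.Integer.Divisibility.Signed as Signed
  using (divides; ∣ᵤ⇒∣; ∣⇒∣ᵤ; ∣m⇒∣-m; ∣m∣n⇒∣m+n; ∣m∣n⇒∣m-n; ∣m⇒∣m*n; ∣n⇒∣m*n)
open import Data.Integer.Properties
  using (≤-antisym; *-cancelʳ-≤-pos; ≮⇒≥; <⇒≱; *-monoʳ-≤-nonNeg; i<j⇒suc[i]≤j; abs-*; +-identityʳ;
         *-identityˡ; *-zeroˡ; *-zeroʳ; *-assoc; *-cancelʳ-≡; *-comm; pos-+; pos-*;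
         neg-distribˡ-*)
open import Data.Integer.Tactic.RingSolver using (solve-∀)
import Data.Nat as ℕ
open import Data.Nat.Coprimality using (Coprime; coprime-Bézout)
open import Data.Nat.Divisibility using (∣-refl) renaming (_∣?_ to _ℕ∣?_)
open import Data.Nat.GCD using (module Bézout)
open import Data.Nat.Primality
  using (euclidsLemma; prime⇒irreducible; prime⇒nonZero; prime[2]; ¬prime[1])
open import Data.Product using (proj₁; proj₂)
open import Data.Sum using (_⊎_; inj₁; inj₂)
open import Function.Bundles using (mk⇔; Equivalence)
open import Level using (0ℓ)
open import Relation.Binary.Bundles using (Setoid)
open import Relation.Binary.PropositionalEquality
  using (refl; sym; trans; cong; subst; module ≡-Reasoning)
import Relation.Binary.Reasoning.Setoid as SetoidReasoning
open import Relation.Nullary using (Dec; yes; no)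
open import Relation.Nullary.Decidable using (map′)

q4-cong : ∀ {a b c d a′ b′ c′ d′} → a ≡ a′ → b ≡ b′ → c ≡ c′ → d ≡ d′ → q4 a b c d ≡ q4 a′ b′ c′ d′
q4-cong refl refl refl refl = refl

q4-ext : ∀ {x y} → re x ≡ re y → im-i x ≡ im-i y → im-j x ≡ im-j y → im-k x ≡ im-k y → x ≡ y
q4-ext = q4-cong

diagonal : ℤ → Q4
diagonal e = q4 e e e e

sumOfSquares : Q4 → ℤ
sumOfSquares (q4 a b c d) = a * a + b * b + c * c + d * d

•-identityˡ : ∀ x → + 1 • x ≡ x
•-identityˡ x =
  q4-ext (*-identityˡ (re x)) (*-identityˡ (im-i x)) (*-identityˡ (im-j x)) (*-identityˡ (im-k x))

•-zeroˡ : ∀ x → + 0 • x ≡ zeroQ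
•-zeroˡ x = q4-ext (*-zeroˡ (re x)) (*-zeroˡ (im-i x)) (*-zeroˡ (im-j x)) (*-zeroˡ (im-k x))

•-zeroʳ : ∀ s → s • zeroQ ≡ zeroQ
•-zeroʳ s = q4-ext (*-zeroʳ s) (*-zeroʳ s) (*-zeroʳ s) (*-zeroʳ s)

•-assoc : ∀ s t x → s • (t • x) ≡ (s * t) • x
•-assoc s t x =
  q4-ext (sym (*-assoc s t (re x))) (sym (*-assoc s t (im-i x)))
         (sym (*-assoc s t (im-j x))) (sym (*-assoc s t (im-k x)))

⊕-identityʳ : ∀ x → x ⊕ zeroQ ≡ x
⊕-identityʳ x =
  q4-ext (+-identityʳ (re x)) (+-identityʳ (im-i x)) (+-identityʳ (im-j x)) (+-identityʳ (im-k x))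

•-distrib-combination : ∀ r s t x y → r • (s • x ⊕ t • y) ≡ (r * s) • x ⊕ (r * t) • y
•-distrib-combination r s t x y =
  q4-ext (distrib r s t (re x) (re y)) (distrib r s t (im-i x) (im-i y))
         (distrib r s t (im-j x) (im-j y)) (distrib r s t (im-k x) (im-k y))
  where
  distrib : ∀ r s t a b → r * (s * a + t * b) ≡ r * s * a + r * t * b
  distrib = solve-∀

combination-unitˡ : ∀ x y → + 1 • x ⊕ + 0 • y ≡ x
combination-unitˡ x y =
  q4-ext (unit (re x) (re y)) (unit (im-i x) (im-i y)) (unit (im-j x) (im-j y)) (unit (im-k x) (im-k y))
  where
  unit : ∀ a b → + 1 * a + + 0 * b ≡ a
  unit = solve-∀

private
  scaled-product-re : ∀ s x₀ x₁ x₂ x₃ z₀ z₁ z₂ z₃ →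
    (s * x₀) * z₀ - (s * x₁) * z₁ - (s * x₂) * z₂ - (s * x₃) * z₃ ≡
      s * (x₀ * z₀ - x₁ * z₁ - x₂ * z₂ - x₃ * z₃)
  scaled-product-re = solve-∀
  scaled-product-i : ∀ s x₀ x₁ x₂ x₃ z₀ z₁ z₂ z₃ →
    (s * x₀) * z₁ + (s * x₁) * z₀ + (s * x₂) * z₃ - (s * x₃) * z₂ ≡
      s * (x₀ * z₁ + x₁ * z₀ + x₂ * z₃ - x₃ * z₂)
  scaled-product-i = solve-∀
  scaled-product-j : ∀ s x₀ x₁ x₂ x₃ z₀ z₁ z₂ z₃ →
    (s * x₀) * z₂ - (s * x₁) * z₃ + (s * x₂) * z₀ + (s * x₃) * z₁ ≡
      s * (x₀ * z₂ - x₁ * z₃ + x₂ * z₀ + x₃ * z₁)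
  scaled-product-j = solve-∀
  scaled-product-k : ∀ s x₀ x₁ x₂ x₃ z₀ z₁ z₂ z₃ →
    (s * x₀) * z₃ + (s * x₁) * z₂ - (s * x₂) * z₁ + (s * x₃) * z₀ ≡
      s * (x₀ * z₃ + x₁ * z₂ - x₂ * z₁ + x₃ * z₀)
  scaled-product-k = solve-∀

  combined-product-re : ∀ s t x₀ x₁ x₂ x₃ y₀ y₁ y₂ y₃ z₀ z₁ z₂ z₃ →
    (s * x₀ + t * y₀) * z₀ - (s * x₁ + t * y₁) * z₁ - (s * x₂ + t * y₂) * z₂ - (s * x₃ + t * y₃) * z₃ ≡
      s * (x₀ * z₀ - x₁ * z₁ - x₂ * z₂ - x₃ * z₃) + t * (y₀ * z₀ - y₁ * z₁ - y₂ * z₂ - y₃ * z₃)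
  combined-product-re = solve-∀
  combined-product-i : ∀ s t x₀ x₁ x₂ x₃ y₀ y₁ y₂ y₃ z₀ z₁ z₂ z₃ →
    (s * x₀ + t * y₀) * z₁ + (s * x₁ + t * y₁) * z₀ + (s * x₂ + t * y₂) * z₃ - (s * x₃ + t * y₃) * z₂ ≡
      s * (x₀ * z₁ + x₁ * z₀ + x₂ * z₃ - x₃ * z₂) + t * (y₀ * z₁ + y₁ * z₀ + y₂ * z₃ - y₃ * z₂)
  combined-product-i = solve-∀
  combined-product-j : ∀ s t x₀ x₁ x₂ x₃ y₀ y₁ y₂ y₃ z₀ z₁ z₂ z₃ →
    (s * x₀ + t * y₀) * z₂ - (s * x₁ + t * y₁) * z₃ + (s * x₂ + t * y₂) * z₀ + (s * x₃ + t * y₃) * z₁ ≡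
      s * (x₀ * z₂ - x₁ * z₃ + x₂ * z₀ + x₃ * z₁) + t * (y₀ * z₂ - y₁ * z₃ + y₂ * z₀ + y₃ * z₁)
  combined-product-j = solve-∀
  combined-product-k : ∀ s t x₀ x₁ x₂ x₃ y₀ y₁ y₂ y₃ z₀ z₁ z₂ z₃ →
    (s * x₀ + t * y₀) * z₃ + (s * x₁ + t * y₁) * z₂ - (s * x₂ + t * y₂) * z₁ + (s * x₃ + t * y₃) * z₀ ≡
      s * (x₀ * z₃ + x₁ * z₂ - x₂ * z₁ + x₃ * z₀) + t * (y₀ * z₃ + y₁ * z₂ - y₂ * z₁ + y₃ * z₀)
  combined-product-k = solve-∀

·-•-assocˡ : ∀ s x z → (s • x) · z ≡ s • (x · z)
·-•-assocˡ s (q4 x₀ x₁ x₂ x₃) (q4 z₀ z₁ z₂ z₃) =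
  q4-ext (scaled-product-re s x₀ x₁ x₂ x₃ z₀ z₁ z₂ z₃) (scaled-product-i s x₀ x₁ x₂ x₃ z₀ z₁ z₂ z₃)
         (scaled-product-j s x₀ x₁ x₂ x₃ z₀ z₁ z₂ z₃) (scaled-product-k s x₀ x₁ x₂ x₃ z₀ z₁ z₂ z₃)

·-linearˡ : ∀ s t x y z → (s • x ⊕ t • y) · z ≡ s • (x · z) ⊕ t • (y · z)
·-linearˡ s t (q4 x₀ x₁ x₂ x₃) (q4 y₀ y₁ y₂ y₃) (q4 z₀ z₁ z₂ z₃) =
  q4-ext (combined-product-re s t x₀ x₁ x₂ x₃ y₀ y₁ y₂ y₃ z₀ z₁ z₂ z₃)
         (combined-product-i s t x₀ x₁ x₂ x₃ y₀ y₁ y₂ y₃ z₀ z₁ z₂ z₃)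
         (combined-product-j s t x₀ x₁ x₂ x₃ y₀ y₁ y₂ y₃ z₀ z₁ z₂ z₃)
         (combined-product-k s t x₀ x₁ x₂ x₃ y₀ y₁ y₂ y₃ z₀ z₁ z₂ z₃)

-- Congruences modulo m

-- Record copies of the congruences _≡[_]_ and _≈[_]_ of Defs.  Those unfold during unification,
-- which leaves their arguments uninferable; these do not.
infix 4 _≡_mod_ _≈_mod_

record _≡_mod_ (x y : ℤ) (m : ℕ) : Set where
  constructor lift-mod
  field lower-mod : x ≡[ m ] y
open _≡_mod_

record _≈_mod_ (x y : Q4) (m : ℕ) : Set where
  constructor q4-mod
  field
    re-mod   : re x ≡ re y mod m
    im-i-mod : im-i x ≡ im-i y mod m
    im-j-mod : im-j x ≡ im-j y mod m
    im-k-mod : im-k x ≡ im-k y mod m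
open _≈_mod_

private
  neg-of-difference : ∀ x y → - (x - y) ≡ y - x
  neg-of-difference = solve-∀

  difference-telescopes : ∀ x y z → (x - y) + (y - z) ≡ x - z
  difference-telescopes = solve-∀

  difference-of-sums : ∀ x y u v → (x - y) + (u - v) ≡ (x + u) - (y + v)
  difference-of-sums = solve-∀

  difference-of-products : ∀ x y u v → u * (x - y) + y * (u - v) ≡ x * u - y * v
  difference-of-products = solve-∀

  difference-of-differences : ∀ x y u v → (x - y) - (u - v) ≡ (x - u) - (y - v)
  difference-of-differences = solve-∀

  difference-zero : ∀ x → + 0 ≡ x - x
  difference-zero = solve-∀

module _ {m : ℕ} where

  private
    via-divisibility : ∀ {x y z} → z ≡ x - y → + m Signed.∣ z → x ≡ y mod m
    via-divisibility e d = lift-mod (∣⇒∣ᵤ (subst (+ m Signed.∣_) e d))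

    divisibility : ∀ {x y} → x ≡ y mod m → + m Signed.∣ (x - y)
    divisibility (lift-mod h) = ∣ᵤ⇒∣ h

  mod? : ∀ x y → Dec (x ≡ y mod m)
  mod? x y = map′ lift-mod lower-mod (m ℕ∣? ∣ x - y ∣)

  mod-refl : ∀ {x} → x ≡ x mod m
  mod-refl {x} = via-divisibility (difference-zero x) (divides (+ 0) refl)

  mod-reflexive : ∀ {x y} → x ≡ y → x ≡ y mod m
  mod-reflexive refl = mod-refl

  mod-sym : ∀ {x y} → x ≡ y mod m → y ≡ x mod m
  mod-sym {x} {y} h = via-divisibility (neg-of-difference x y) (∣m⇒∣-m (divisibility h))

  mod-trans : ∀ {x y z} → x ≡ y mod m → y ≡ z mod m → x ≡ z mod m
  mod-trans {x} {y} {z} h k =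
    via-divisibility (difference-telescopes x y z) (∣m∣n⇒∣m+n (divisibility h) (divisibility k))

  +-cong-mod : ∀ {x y u v} → x ≡ y mod m → u ≡ v mod m → x + u ≡ y + v mod m
  +-cong-mod {x} {y} {u} {v} h k =
    via-divisibility (difference-of-sums x y u v) (∣m∣n⇒∣m+n (divisibility h) (divisibility k))

  *-cong-mod : ∀ {x y u v} → x ≡ y mod m → u ≡ v mod m → x * u ≡ y * v mod m
  *-cong-mod {x} {y} {u} {v} h k = via-divisibility (difference-of-products x y u v)
    (∣m∣n⇒∣m+n (∣n⇒∣m*n u (divisibility h)) (∣n⇒∣m*n y (divisibility k)))

  minus-cong-mod : ∀ {x y u v} → x ≡ y mod m → u ≡ v mod m → x - u ≡ y - v mod m
  minus-cong-mod {x} {y} {u} {v} h k =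
    via-divisibility (difference-of-differences x y u v) (∣m∣n⇒∣m-n (divisibility h) (divisibility k))

  +-congʳ-mod : ∀ z {x y} → x ≡ y mod m → x + z ≡ y + z mod m
  +-congʳ-mod z h = +-cong-mod h (mod-refl {z})

  *-congˡ-mod : ∀ x {u v} → u ≡ v mod m → x * u ≡ x * v mod m
  *-congˡ-mod x h = *-cong-mod (mod-refl {x}) h

  multiple-mod : ∀ x → + m * x ≡ + 0 mod m
  multiple-mod x = via-divisibility (sym (+-identityʳ (+ m * x))) (∣m⇒∣m*n x Signed.∣-refl)

  from-≈[] : ∀ x y → x ≈[ m ] y → x ≈ y mod m
  from-≈[] _ _ (h₀ , h₁ , h₂ , h₃) = q4-mod (lift-mod h₀) (lift-mod h₁) (lift-mod h₂) (lift-mod h₃)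

  to-≈[] : ∀ x y → x ≈ y mod m → x ≈[ m ] y
  to-≈[] _ _ (q4-mod (lift-mod h₀) (lift-mod h₁) (lift-mod h₂) (lift-mod h₃)) = h₀ , h₁ , h₂ , h₃

  ≈-refl : ∀ {x} → x ≈ x mod m
  ≈-refl = q4-mod mod-refl mod-refl mod-refl mod-refl

  ≈-reflexive : ∀ {x y} → x ≡ y → x ≈ y mod m
  ≈-reflexive refl = ≈-refl

  ≈-sym : ∀ {x y} → x ≈ y mod m → y ≈ x mod m
  ≈-sym (q4-mod h₀ h₁ h₂ h₃) = q4-mod (mod-sym h₀) (mod-sym h₁) (mod-sym h₂) (mod-sym h₃)

  ≈-trans : ∀ {x y z} → x ≈ y mod m → y ≈ z mod m → x ≈ z mod m
  ≈-trans (q4-mod h₀ h₁ h₂ h₃) (q4-mod k₀ k₁ k₂ k₃) =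
    q4-mod (mod-trans h₀ k₀) (mod-trans h₁ k₁) (mod-trans h₂ k₂) (mod-trans h₃ k₃)

  ⊕-congˡ : ∀ x {u v} → u ≈ v mod m → x ⊕ u ≈ x ⊕ v mod m
  ⊕-congˡ x (q4-mod k₀ k₁ k₂ k₃) =
    q4-mod (+-cong-mod (mod-refl {re x}) k₀) (+-cong-mod (mod-refl {im-i x}) k₁)
           (+-cong-mod (mod-refl {im-j x}) k₂) (+-cong-mod (mod-refl {im-k x}) k₃)

  •-congˡ : ∀ s {x y} → x ≈ y mod m → s • x ≈ s • y mod m
  •-congˡ s (q4-mod k₀ k₁ k₂ k₃) =
    q4-mod (*-congˡ-mod s k₀) (*-congˡ-mod s k₁) (*-congˡ-mod s k₂) (*-congˡ-mod s k₃)

  •-congʳ : ∀ {s t} x → s ≡ t mod m → s • x ≈ t • x mod m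
  •-congʳ x h = q4-mod (*-cong-mod h (mod-refl {re x})) (*-cong-mod h (mod-refl {im-i x}))
                       (*-cong-mod h (mod-refl {im-j x})) (*-cong-mod h (mod-refl {im-k x}))

  ·-cong-mod : ∀ {x y u v} → x ≈ y mod m → u ≈ v mod m → x · u ≈ y · v mod m
  ·-cong-mod (q4-mod x₀ x₁ x₂ x₃) (q4-mod u₀ u₁ u₂ u₃) = q4-mod
    (minus-cong-mod (minus-cong-mod (minus-cong-mod (x₀ ⊛ u₀) (x₁ ⊛ u₁)) (x₂ ⊛ u₂)) (x₃ ⊛ u₃))
    (minus-cong-mod (+-cong-mod (+-cong-mod (x₀ ⊛ u₁) (x₁ ⊛ u₀)) (x₂ ⊛ u₃)) (x₃ ⊛ u₂))
    (+-cong-mod (+-cong-mod (minus-cong-mod (x₀ ⊛ u₂) (x₁ ⊛ u₃)) (x₂ ⊛ u₀)) (x₃ ⊛ u₁))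
    (+-cong-mod (minus-cong-mod (+-cong-mod (x₀ ⊛ u₃) (x₁ ⊛ u₂)) (x₂ ⊛ u₁)) (x₃ ⊛ u₀))
    where
    _⊛_ = *-cong-mod

  •-zero-mod : ∀ s x → s ≡ + 0 mod m → s • x ≈ zeroQ mod m
  •-zero-mod s x h = ≈-trans (•-congʳ x h) (≈-reflexive (•-zeroˡ x))

ℤ-mod : ℕ → Setoid 0ℓ 0ℓ
ℤ-mod m = record
  { Carrier = ℤ ; _≈_ = λ x y → x ≡ y mod m
  ; isEquivalence = record { refl = mod-refl ; sym = mod-sym ; trans = mod-trans } }

Q4-mod : ℕ → Setoid 0ℓ 0ℓ
Q4-mod m = record
  { Carrier = Q4 ; _≈_ = λ x y → x ≈ y mod m
  ; isEquivalence = record { refl = ≈-refl ; sym = ≈-sym ; trans = ≈-trans } }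

•-solve : ∀ {m} c c⁻¹ x {z} → c⁻¹ * c ≡ + 1 mod m → c • x ≈ z mod m → x ≈ c⁻¹ • z mod m
•-solve {m} c c⁻¹ x {z} c⁻¹c≡1 h = begin
  x               ≡⟨ •-identityˡ x ⟨
  + 1 • x         ≈⟨ •-congʳ x (mod-sym c⁻¹c≡1) ⟩
  (c⁻¹ * c) • x   ≡⟨ •-assoc c⁻¹ c x ⟨
  c⁻¹ • (c • x)   ≈⟨ •-congˡ c⁻¹ h ⟩
  c⁻¹ • z         ∎
  where open SetoidReasoning (Q4-mod m)

-- Arithmetic modulo a prime

module _ {p : ℕ} (p-prime : Prime p) where

  private
    bézout-in-ℤ : ∀ a b c d → 1 ℕ.+ a ℕ.* b ≡ c ℕ.* d → + 1 + + a * + b ≡ + c * + d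
    bézout-in-ℤ a b c d e =
      trans (sym (trans (pos-+ 1 (a ℕ.* b)) (cong (_+_ (+ 1)) (pos-* a b))))
            (trans (cong +_ e) (pos-* c d))

    negated-one-plus : ∀ t k → - t * k - + 1 ≡ - (+ 1 + t * k)
    negated-one-plus = solve-∀

    one-plus-minus-one : ∀ a → (+ 1 + a) - + 1 ≡ a
    one-plus-minus-one = solve-∀

    bézout-+- : ∀ t k s q → + 1 + t * k ≡ s * q → - t * k - + 1 ≡ - s * q
    bézout-+- t k s q e = trans (negated-one-plus t k) (trans (cong -_ e) (neg-distribˡ-* s q))

    bézout--+ : ∀ s q t k → + 1 + s * q ≡ t * k → t * k - + 1 ≡ s * q
    bézout--+ s q t k e = trans (cong (_- + 1) (sym e)) (one-plus-minus-one (s * q))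

    negate-factors : ∀ y k → y * k - + 1 ≡ - y * - k - + 1
    negate-factors = solve-∀

    divides-abs : ∀ {x} → x ≡ + 0 mod p → p ∣ ∣ x ∣
    divides-abs {x} (lift-mod h) = subst (λ z → p ∣ ∣ z ∣) (+-identityʳ x) h

    from-divides-abs : ∀ {x} → p ∣ ∣ x ∣ → x ≡ + 0 mod p
    from-divides-abs {x} h = lift-mod (subst (λ z → p ∣ ∣ z ∣) (sym (+-identityʳ x)) h)

  mod-euclid : ∀ x y → x * y ≡ + 0 mod p → x ≡ + 0 mod p ⊎ y ≡ + 0 mod p
  mod-euclid x y h with euclidsLemma ∣ x ∣ ∣ y ∣ p-prime (subst (p ∣_) (abs-* x y) (divides-abs h))
  ... | inj₁ p∣x = inj₁ (from-divides-abs p∣x)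
  ... | inj₂ p∣y = inj₂ (from-divides-abs p∣y)

  mod-zero-productˡ : ∀ {x y} → ¬ x ≡ + 0 mod p → x * y ≡ + 0 mod p → y ≡ + 0 mod p
  mod-zero-productˡ {x} {y} x≢0 h with mod-euclid x y h
  ... | inj₁ x≡0 = ⊥-elim (x≢0 x≡0)
  ... | inj₂ y≡0 = y≡0

  mod-zero-productʳ : ∀ {x y} → ¬ y ≡ + 0 mod p → x * y ≡ + 0 mod p → x ≡ + 0 mod p
  mod-zero-productʳ {x} {y} y≢0 h with mod-euclid x y h
  ... | inj₁ x≡0 = x≡0
  ... | inj₂ y≡0 = ⊥-elim (y≢0 y≡0)

  mod-nonzero-* : ∀ {x y} → ¬ x ≡ + 0 mod p → ¬ y ≡ + 0 mod p → ¬ x * y ≡ + 0 mod p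
  mod-nonzero-* x≢0 y≢0 h = y≢0 (mod-zero-productˡ x≢0 h)

  mod-square : ∀ {x} → x * x ≡ + 0 mod p → x ≡ + 0 mod p
  mod-square {x} h with mod-euclid x x h
  ... | inj₁ x≡0 = x≡0
  ... | inj₂ x≡0 = x≡0

  mod-inverse : ∀ {x} → ¬ x ≡ + 0 mod p → Σ ℤ λ x⁻¹ → x⁻¹ * x ≡ + 1 mod p
  mod-inverse {x} x≢0 = restoreSign x (inverseOfAbs (coprime-Bézout coprime))
    where
    coprime : Coprime p ∣ x ∣
    coprime (d∣p , d∣x) with prime⇒irreducible p-prime d∣p
    ... | inj₁ d≡1 = d≡1
    ... | inj₂ refl = ⊥-elim (x≢0 (from-divides-abs d∣x))
    inverseOfAbs : Bézout.Identity 1 p ∣ x ∣ → Σ ℤ λ y → + p Signed.∣ (y * + ∣ x ∣ - + 1)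
    inverseOfAbs (Bézout.+- s t e) =
      - + t , divides (- + s) (bézout-+- (+ t) (+ ∣ x ∣) (+ s) (+ p) (bézout-in-ℤ t ∣ x ∣ s p e))
    inverseOfAbs (Bézout.-+ s t e) =
      + t , divides (+ s) (bézout--+ (+ s) (+ p) (+ t) (+ ∣ x ∣) (bézout-in-ℤ s p t ∣ x ∣ e))
    restoreSign : ∀ x → (Σ ℤ λ y → + p Signed.∣ (y * + ∣ x ∣ - + 1)) → Σ ℤ λ y → y * x ≡ + 1 mod p
    restoreSign (+ _)    (y , d) = y , lift-mod (∣⇒∣ᵤ d)
    restoreSign -[1+ n ] (y , d) =
      - y , lift-mod (∣⇒∣ᵤ (subst (+ p Signed.∣_) (negate-factors y (+ ℕ.suc n)) d))

  2≢0-mod : ¬ 2 ∣ p → ¬ + 2 ≡ + 0 mod p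
  2≢0-mod p-odd (lift-mod p∣2) with prime⇒irreducible prime[2] p∣2
  ... | inj₁ p≡1 = ¬prime[1] (subst Prime p≡1 p-prime)
  ... | inj₂ p≡2 = p-odd (subst (2 ∣_) (sym p≡2) ∣-refl)

  •-zero-divisor : ∀ c x → c • x ≈ zeroQ mod p → ¬ x ≈ zeroQ mod p → c ≡ + 0 mod p
  •-zero-divisor c x h x≉0 with mod? c (+ 0)
  ... | yes c≡0 = c≡0
  ... | no  c≢0 with mod-inverse c≢0
  ... | c⁻¹ , c⁻¹c≡1 = ⊥-elim (x≉0 (≈-trans (•-solve c c⁻¹ x c⁻¹c≡1 h) (≈-reflexive (•-zeroʳ c⁻¹))))

-- Planes in ℋ/pℋ

Spans : ℕ → (Q4 → Set) → Q4 → Q4 → Set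
Spans p Π u v = ∀ x → Π x ⇔ (Σ ℤ λ s → Σ ℤ λ t → x ≈[ p ] ((s • u) ⊕ (t • v)))

Independent : ℕ → Q4 → Q4 → Set
Independent p u v = ∀ s t → ((s • u) ⊕ (t • v)) ≈[ p ] zeroQ → (s ≡[ p ] + 0) × (t ≡[ p ] + 0)

IsPlane : ℕ → (Q4 → Set) → Set
IsPlane p Π = Σ Q4 λ u → Σ Q4 λ v → Spans p Π u v × Independent p u v

HasUniqueTracelessLine : ℕ → (Q4 → Set) → Set
HasUniqueTracelessLine p Π =
  Σ Q4 λ w → Π w × ¬ (w ≈[ p ] zeroQ) × (tr w ≡[ p ] + 0) ×
    (∀ w' → Π w' → ¬ (w' ≈[ p ] zeroQ) → tr w' ≡[ p ] + 0 →
      Σ ℤ λ c → ¬ (c ≡[ p ] + 0) × (w' ≈[ p ] (c • w)))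

module _ {p : ℕ} (p-prime : Prime p) (p-odd : ¬ 2 ∣ p) {Π : Q4 → Set} {w v : Q4}
         (Π-spanned : Spans p Π w v) (w-traceless : re w ≡ + 0 mod p)
         (w≉0 : ¬ w ≈ zeroQ mod p) (re-v≢0 : ¬ re v ≡ + 0 mod p) where

  private
    zero-summand : ∀ a b → a * + 0 + b ≡ b
    zero-summand = solve-∀

    re-combination : ∀ s t → re (s • w ⊕ t • v) ≡ t * re v mod p
    re-combination s t = begin
      s * re w + t * re v   ≈⟨ +-congʳ-mod (t * re v) (*-congˡ-mod s w-traceless) ⟩
      s * + 0 + t * re v    ≡⟨ zero-summand s (t * re v) ⟩
      t * re v              ∎
      where open SetoidReasoning (ℤ-mod p)

    v-coefficient : ∀ x s t → x ≈ s • w ⊕ t • v mod p → re x ≡ + 0 mod p → t ≡ + 0 mod p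
    v-coefficient x s t x≈ re-x≡0 = mod-zero-productʳ p-prime re-v≢0 (begin
      t * re v              ≈⟨ re-combination s t ⟨
      re (s • w ⊕ t • v)    ≈⟨ re-mod x≈ ⟨
      re x                  ≈⟨ re-x≡0 ⟩
      + 0                   ∎)
      where open SetoidReasoning (ℤ-mod p)

    on-w-line : ∀ x s t → x ≈ s • w ⊕ t • v mod p → re x ≡ + 0 mod p → x ≈ s • w mod p
    on-w-line x s t x≈ re-x≡0 = begin
      x                ≈⟨ x≈ ⟩
      s • w ⊕ t • v    ≈⟨ ⊕-congˡ (s • w) (•-zero-mod t v (v-coefficient x s t x≈ re-x≡0)) ⟩
      s • w ⊕ zeroQ    ≡⟨ ⊕-identityʳ (s • w) ⟩
      s • w            ∎
      where open SetoidReasoning (Q4-mod p)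

  independent : Independent p w v
  independent s t h =
    lower-mod (•-zero-divisor p-prime s w (≈-sym (on-w-line zeroQ s t 0≈ mod-refl)) w≉0) ,
    lower-mod (v-coefficient zeroQ s t 0≈ mod-refl)
    where
    0≈ : zeroQ ≈ s • w ⊕ t • v mod p
    0≈ = ≈-sym (from-≈[] (s • w ⊕ t • v) zeroQ h)

  unique-traceless-line : HasUniqueTracelessLine p Π
  unique-traceless-line =
    w , w∈Π , (λ h → w≉0 (from-≈[] w zeroQ h)) , lower-mod (*-congˡ-mod (+ 2) w-traceless) , unique
    where
    w∈Π : Π w
    w∈Π = Equivalence.from (Π-spanned w)
            (+ 1 , + 0 , to-≈[] w (+ 1 • w ⊕ + 0 • v) (≈-reflexive (sym (combination-unitˡ w v))))
    unique : ∀ w′ → Π w′ → ¬ (w′ ≈[ p ] zeroQ) → tr w′ ≡[ p ] + 0 →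
             Σ ℤ λ c → ¬ (c ≡[ p ] + 0) × (w′ ≈[ p ] (c • w))
    unique w′ w′∈Π w′≉0 tr≡0 with Equivalence.to (Π-spanned w′) w′∈Π
    ... | s , t , w′≈ = s , s≢0 , to-≈[] w′ (s • w) w′≈sw
      where
      re-w′≡0 : re w′ ≡ + 0 mod p
      re-w′≡0 = mod-zero-productˡ p-prime (2≢0-mod p-prime p-odd) (lift-mod tr≡0)
      w′≈sw : w′ ≈ s • w mod p
      w′≈sw = on-w-line w′ s t (from-≈[] w′ (s • w ⊕ t • v) w′≈) re-w′≡0
      s≢0 : ¬ s ≡[ p ] + 0
      s≢0 s≡0 = w′≉0 (to-≈[] w′ zeroQ (≈-trans w′≈sw (•-zero-mod s w (lift-mod s≡0))))

  plane-with-unique-traceless-line : IsPlane p Π × HasUniqueTracelessLine p Π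
  plane-with-unique-traceless-line = (w , v , Π-spanned , independent) , unique-traceless-line

-- Hurwitz integers

private
  doubles-congruent : ∀ x y → + 2 * x ≡[ 2 ] + 2 * y
  doubles-congruent x y = ∣⇒∣ᵤ (divides (x - y) (difference-of-doubles x y))
    where
    difference-of-doubles : ∀ x y → + 2 * x - + 2 * y ≡ (x - y) * + 2
    difference-of-doubles = solve-∀

  even-mod : ∀ {z} k → z ≡ k * + 2 → z ≡ + 0 mod 2
  even-mod {z} k e = lift-mod (∣⇒∣ᵤ (divides k (trans (+-identityʳ z) e)))

double-isHurwitz : ∀ x → IsHurwitz (+ 2 • x)
double-isHurwitz (q4 a b c d) = doubles-congruent a b , doubles-congruent b c , doubles-congruent c d

hurwitz-coordinates : ∀ x → IsHurwitz x →
  (im-i x ≡ re x mod 2) × (im-j x ≡ re x mod 2) × (im-k x ≡ re x mod 2)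
hurwitz-coordinates x (a≡b , b≡c , c≡d) = b≡a , c≡a , mod-trans (mod-sym (lift-mod c≡d)) c≡a
  where
  b≡a = mod-sym (lift-mod a≡b)
  c≡a = mod-trans (mod-sym (lift-mod b≡c)) b≡a

hurwitz-≈-diagonal : ∀ x → IsHurwitz x → x ≈ diagonal (re x) mod 2
hurwitz-≈-diagonal x x-hurwitz = q4-mod mod-refl b≡a c≡a d≡a
  where
  b≡a = proj₁ (hurwitz-coordinates x x-hurwitz)
  c≡a = proj₁ (proj₂ (hurwitz-coordinates x x-hurwitz))
  d≡a = proj₂ (proj₂ (hurwitz-coordinates x x-hurwitz))

-- Since (1 + i + j + k)² = 2(−1 + i + j + k).
diagonal-product-even : ∀ e f → diagonal e · diagonal f ≈ zeroQ mod 2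
diagonal-product-even e f =
  q4-mod (even-mod (- (e * f)) (three-minus (e * f))) (even-mod (e * f) (fourth-minus (e * f)))
         (even-mod (e * f) (second-minus (e * f))) (even-mod (e * f) (third-minus (e * f)))
  where
  three-minus : ∀ z → z - z - z - z ≡ (- z) * + 2
  three-minus = solve-∀
  second-minus : ∀ z → z - z + z + z ≡ z * + 2
  second-minus = solve-∀
  third-minus : ∀ z → z + z - z + z ≡ z * + 2
  third-minus = solve-∀
  fourth-minus : ∀ z → z + z + z - z ≡ z * + 2
  fourth-minus = solve-∀

hurwitz-·-even : ∀ x y → IsHurwitz x → IsHurwitz y → x · y ≈ zeroQ mod 2
hurwitz-·-even x y x-hurwitz y-hurwitz =
  ≈-trans (·-cong-mod (hurwitz-≈-diagonal x x-hurwitz) (hurwitz-≈-diagonal y y-hurwitz))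
          (diagonal-product-even (re x) (re y))

/ℕ-exact : ∀ a d → (a * + ℕ.suc d) /ℕ ℕ.suc d ≡ a
/ℕ-exact a d = ≤-antisym q≤a a≤q
  where
  q = (a * + ℕ.suc d) /ℕ ℕ.suc d
  q≤a : q ≤ a
  q≤a = *-cancelʳ-≤-pos q a (+ ℕ.suc d) ([n/ℕd]*d≤n (a * + ℕ.suc d) (ℕ.suc d))
  a≤q : a ≤ q
  a≤q = ≮⇒≥ λ q<a → <⇒≱ (n<s[n/ℕd]*d (a * + ℕ.suc d) (ℕ.suc d))
                         (*-monoʳ-≤-nonNeg (+ ℕ.suc d) (i<j⇒suc[i]≤j q<a))

half-of-even : ∀ z → z ≡ + 0 mod 2 → + 2 * (z /ℕ 2) ≡ z
half-of-even z (lift-mod h) with ∣ᵤ⇒∣ h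
... | divides k e = begin
  + 2 * (z /ℕ 2)           ≡⟨ cong (λ n → + 2 * (n /ℕ 2)) z≡2k ⟩
  + 2 * ((k * + 2) /ℕ 2)   ≡⟨ cong (_*_ (+ 2)) (/ℕ-exact k 1) ⟩
  + 2 * k                  ≡⟨ *-comm (+ 2) k ⟩
  k * + 2                  ≡⟨ z≡2k ⟨
  z                        ∎
  where
  open ≡-Reasoning
  z≡2k = trans (sym (+-identityʳ z)) e

half-double : ∀ x → half (+ 2 • x) ≡ x
half-double x = q4-ext (halve (re x)) (halve (im-i x)) (halve (im-j x)) (halve (im-k x))
  where
  halve : ∀ a → (+ 2 * a) /ℕ 2 ≡ a
  halve a = trans (cong (_/ℕ 2) (*-comm (+ 2) a)) (/ℕ-exact a 1)

⊗-double : ∀ x y → IsHurwitz x → IsHurwitz y → + 2 • (x ⊗ y) ≡ x · y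
⊗-double x y x-hurwitz y-hurwitz =
  q4-ext (half-of-even _ (re-mod even)) (half-of-even _ (im-i-mod even))
         (half-of-even _ (im-j-mod even)) (half-of-even _ (im-k-mod even))
  where
  even = hurwitz-·-even x y x-hurwitz y-hurwitz

square-cong-mod : ∀ {x y} → x ≡ y mod 2 → x * x ≡ y * y mod 4
square-cong-mod {x} {y} (lift-mod h) with ∣ᵤ⇒∣ h
... | divides k e = lift-mod (∣⇒∣ᵤ (divides (k * (y + k)) x²-y²≡4k[y+k]))
  where
  x≡y+2k : x ≡ y + k * + 2
  x≡y+2k = trans (sum-of-difference x y) (cong (_+_ y) e)
    where
    sum-of-difference : ∀ x y → x ≡ y + (x - y)
    sum-of-difference = solve-∀
  square-shift : ∀ y k → (y + k * + 2) * (y + k * + 2) - y * y ≡ k * (y + k) * + 4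
  square-shift = solve-∀
  x²-y²≡4k[y+k] : x * x - y * y ≡ k * (y + k) * + 4
  x²-y²≡4k[y+k] = subst (λ z → z * z - y * y ≡ k * (y + k) * + 4) (sym x≡y+2k) (square-shift y k)

hurwitz-sumOfSquares-mod-4 : ∀ x → IsHurwitz x → sumOfSquares x ≡ + 0 mod 4
hurwitz-sumOfSquares-mod-4 x x-hurwitz = begin
  sumOfSquares x       ≈⟨ +-cong-mod (+-cong-mod (+-cong-mod (mod-refl {x = a²}) (square-cong-mod b≡a))
                                                 (square-cong-mod c≡a))
                                     (square-cong-mod d≡a) ⟩
  a² + a² + a² + a²    ≡⟨ four-times a² ⟩
  + 4 * a²             ≈⟨ multiple-mod a² ⟩
  + 0                  ∎
  where
  open SetoidReasoning (ℤ-mod 4)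
  a² = re x * re x
  b≡a = proj₁ (hurwitz-coordinates x x-hurwitz)
  c≡a = proj₁ (proj₂ (hurwitz-coordinates x x-hurwitz))
  d≡a = proj₂ (proj₂ (hurwitz-coordinates x x-hurwitz))
  four-times : ∀ z → z + z + z + z ≡ + 4 * z
  four-times = solve-∀

hurwitz-sumOfSquares : ∀ x → IsHurwitz x → sumOfSquares x ≡ normH x * + 4
hurwitz-sumOfSquares x x-hurwitz with ∣ᵤ⇒∣ (lower-mod (hurwitz-sumOfSquares-mod-4 x x-hurwitz))
... | divides k e = begin
  sumOfSquares x         ≡⟨ N≡4k ⟩
  k * + 4                ≡⟨ cong (_* + 4) (/ℕ-exact k 3) ⟨
  (k * + 4) /ℕ 4 * + 4   ≡⟨ cong (λ n → n /ℕ 4 * + 4) N≡4k ⟨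
  normH x * + 4          ∎
  where
  open ≡-Reasoning
  N≡4k = trans (sym (+-identityʳ (sumOfSquares x))) e

-- The plane attached to an imaginary axis

data Axis : Set where
  i j k : Axis

coordinate : Axis → Q4 → ℤ
coordinate i = im-i
coordinate j = im-j
coordinate k = im-k

axialNorm : Axis → Q4 → ℤ
axialNorm u x = re x * re x + coordinate u x * coordinate u x

tracelessFactor realFactor axialPart orthogonalPart : Axis → Q4 → Q4
tracelessFactor i x = q4 (im-i x) (re x) (+ 0) (+ 0)
tracelessFactor j x = q4 (im-j x) (+ 0) (re x) (+ 0)
tracelessFactor k x = q4 (im-k x) (+ 0) (+ 0) (re x)
realFactor i x = q4 (re x) (- im-i x) (+ 0) (+ 0)
realFactor j x = q4 (re x) (+ 0) (- im-j x) (+ 0)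
realFactor k x = q4 (re x) (+ 0) (+ 0) (- im-k x)
axialPart i x = q4 (re x) (im-i x) (+ 0) (+ 0)
axialPart j x = q4 (re x) (+ 0) (im-j x) (+ 0)
axialPart k x = q4 (re x) (+ 0) (+ 0) (im-k x)
orthogonalPart i x = q4 (+ 0) (+ 0) (im-j x) (im-k x)
orthogonalPart j x = q4 (+ 0) (im-i x) (+ 0) (im-k x)
orthogonalPart k x = q4 (+ 0) (im-i x) (im-j x) (+ 0)

private
  axis-i-re : ∀ g₀ g₁ g₂ g₃ a b c d →
    (a * a + b * b) * (g₀ * a - g₁ * b - g₂ * c - g₃ * d) ≡
      (g₀ * b + g₁ * a + g₂ * d - g₃ * c) * (b * a - a * b - + 0 * c - + 0 * d)
        + (g₀ * a - g₁ * b - g₂ * c - g₃ * d) * (a * a - (- b) * b - + 0 * c - + 0 * d)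
        + (a * a + b * b + c * c + d * d) * (+ 0 * a - + 0 * b - g₂ * + 0 - g₃ * + 0)
  axis-i-re = solve-∀
  axis-i-i : ∀ g₀ g₁ g₂ g₃ a b c d →
    (a * a + b * b) * (g₀ * b + g₁ * a + g₂ * d - g₃ * c) ≡
      (g₀ * b + g₁ * a + g₂ * d - g₃ * c) * (b * b + a * a + + 0 * d - + 0 * c)
        + (g₀ * a - g₁ * b - g₂ * c - g₃ * d) * (a * b + (- b) * a + + 0 * d - + 0 * c)
        + (a * a + b * b + c * c + d * d) * (+ 0 * b + + 0 * a + g₂ * + 0 - g₃ * + 0)
  axis-i-i = solve-∀
  axis-i-j : ∀ g₀ g₁ g₂ g₃ a b c d →
    (a * a + b * b) * (g₀ * c - g₁ * d + g₂ * a + g₃ * b) ≡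
      (g₀ * b + g₁ * a + g₂ * d - g₃ * c) * (b * c - a * d + + 0 * a + + 0 * b)
        + (g₀ * a - g₁ * b - g₂ * c - g₃ * d) * (a * c - (- b) * d + + 0 * a + + 0 * b)
        + (a * a + b * b + c * c + d * d) * (+ 0 * + 0 - + 0 * + 0 + g₂ * a + g₃ * b)
  axis-i-j = solve-∀
  axis-i-k : ∀ g₀ g₁ g₂ g₃ a b c d →
    (a * a + b * b) * (g₀ * d + g₁ * c - g₂ * b + g₃ * a) ≡
      (g₀ * b + g₁ * a + g₂ * d - g₃ * c) * (b * d + a * c - + 0 * b + + 0 * a)
        + (g₀ * a - g₁ * b - g₂ * c - g₃ * d) * (a * d + (- b) * c - + 0 * b + + 0 * a)
        + (a * a + b * b + c * c + d * d) * (+ 0 * + 0 + + 0 * + 0 - g₂ * b + g₃ * a)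
  axis-i-k = solve-∀

  axis-j-re : ∀ g₀ g₁ g₂ g₃ a b c d →
    (a * a + c * c) * (g₀ * a - g₁ * b - g₂ * c - g₃ * d) ≡
      (g₀ * c - g₁ * d + g₂ * a + g₃ * b) * (c * a - + 0 * b - a * c - + 0 * d)
        + (g₀ * a - g₁ * b - g₂ * c - g₃ * d) * (a * a - + 0 * b - (- c) * c - + 0 * d)
        + (a * a + b * b + c * c + d * d) * (+ 0 * a - g₁ * + 0 - + 0 * c - g₃ * + 0)
  axis-j-re = solve-∀
  axis-j-i : ∀ g₀ g₁ g₂ g₃ a b c d →
    (a * a + c * c) * (g₀ * b + g₁ * a + g₂ * d - g₃ * c) ≡
      (g₀ * c - g₁ * d + g₂ * a + g₃ * b) * (c * b + + 0 * a + a * d - + 0 * c)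
        + (g₀ * a - g₁ * b - g₂ * c - g₃ * d) * (a * b + + 0 * a + (- c) * d - + 0 * c)
        + (a * a + b * b + c * c + d * d) * (+ 0 * + 0 + g₁ * a + + 0 * + 0 - g₃ * c)
  axis-j-i = solve-∀
  axis-j-j : ∀ g₀ g₁ g₂ g₃ a b c d →
    (a * a + c * c) * (g₀ * c - g₁ * d + g₂ * a + g₃ * b) ≡
      (g₀ * c - g₁ * d + g₂ * a + g₃ * b) * (c * c - + 0 * d + a * a + + 0 * b)
        + (g₀ * a - g₁ * b - g₂ * c - g₃ * d) * (a * c - + 0 * d + (- c) * a + + 0 * b)
        + (a * a + b * b + c * c + d * d) * (+ 0 * c - g₁ * + 0 + + 0 * a + g₃ * + 0)
  axis-j-j = solve-∀
  axis-j-k : ∀ g₀ g₁ g₂ g₃ a b c d →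
    (a * a + c * c) * (g₀ * d + g₁ * c - g₂ * b + g₃ * a) ≡
      (g₀ * c - g₁ * d + g₂ * a + g₃ * b) * (c * d + + 0 * c - a * b + + 0 * a)
        + (g₀ * a - g₁ * b - g₂ * c - g₃ * d) * (a * d + + 0 * c - (- c) * b + + 0 * a)
        + (a * a + b * b + c * c + d * d) * (+ 0 * + 0 + g₁ * c - + 0 * + 0 + g₃ * a)
  axis-j-k = solve-∀

  axis-k-re : ∀ g₀ g₁ g₂ g₃ a b c d →
    (a * a + d * d) * (g₀ * a - g₁ * b - g₂ * c - g₃ * d) ≡
      (g₀ * d + g₁ * c - g₂ * b + g₃ * a) * (d * a - + 0 * b - + 0 * c - a * d)
        + (g₀ * a - g₁ * b - g₂ * c - g₃ * d) * (a * a - + 0 * b - + 0 * c - (- d) * d)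
        + (a * a + b * b + c * c + d * d) * (+ 0 * a - g₁ * + 0 - g₂ * + 0 - + 0 * d)
  axis-k-re = solve-∀
  axis-k-i : ∀ g₀ g₁ g₂ g₃ a b c d →
    (a * a + d * d) * (g₀ * b + g₁ * a + g₂ * d - g₃ * c) ≡
      (g₀ * d + g₁ * c - g₂ * b + g₃ * a) * (d * b + + 0 * a + + 0 * d - a * c)
        + (g₀ * a - g₁ * b - g₂ * c - g₃ * d) * (a * b + + 0 * a + + 0 * d - (- d) * c)
        + (a * a + b * b + c * c + d * d) * (+ 0 * + 0 + g₁ * a + g₂ * d - + 0 * + 0)
  axis-k-i = solve-∀
  axis-k-j : ∀ g₀ g₁ g₂ g₃ a b c d →
    (a * a + d * d) * (g₀ * c - g₁ * d + g₂ * a + g₃ * b) ≡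
      (g₀ * d + g₁ * c - g₂ * b + g₃ * a) * (d * c - + 0 * d + + 0 * a + a * b)
        + (g₀ * a - g₁ * b - g₂ * c - g₃ * d) * (a * c - + 0 * d + + 0 * a + (- d) * b)
        + (a * a + b * b + c * c + d * d) * (+ 0 * + 0 - g₁ * d + g₂ * a + + 0 * + 0)
  axis-k-j = solve-∀
  axis-k-k : ∀ g₀ g₁ g₂ g₃ a b c d →
    (a * a + d * d) * (g₀ * d + g₁ * c - g₂ * b + g₃ * a) ≡
      (g₀ * d + g₁ * c - g₂ * b + g₃ * a) * (d * d + + 0 * c - + 0 * b + a * a)
        + (g₀ * a - g₁ * b - g₂ * c - g₃ * d) * (a * d + + 0 * c - + 0 * b + (- d) * a)
        + (a * a + b * b + c * c + d * d) * (+ 0 * d + g₁ * + 0 - g₂ * + 0 + + 0 * a)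
  axis-k-k = solve-∀

  generator-i-re-w : ∀ a b c d → b * a - a * b - + 0 * c - + 0 * d ≡ + 0
  generator-i-re-w = solve-∀
  generator-i-w : ∀ a b c d → b * b + a * a + + 0 * d - + 0 * c ≡ a * a + b * b
  generator-i-w = solve-∀
  generator-i-re-v : ∀ a b c d → a * a - (- b) * b - + 0 * c - + 0 * d ≡ a * a + b * b
  generator-i-re-v = solve-∀
  generator-j-re-w : ∀ a b c d → c * a - + 0 * b - a * c - + 0 * d ≡ + 0
  generator-j-re-w = solve-∀
  generator-j-w : ∀ a b c d → c * c - + 0 * d + a * a + + 0 * b ≡ a * a + c * c
  generator-j-w = solve-∀
  generator-j-re-v : ∀ a b c d → a * a - + 0 * b - (- c) * c - + 0 * d ≡ a * a + c * c
  generator-j-re-v = solve-∀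
  generator-k-re-w : ∀ a b c d → d * a - + 0 * b - + 0 * c - a * d ≡ + 0
  generator-k-re-w = solve-∀
  generator-k-w : ∀ a b c d → d * d + + 0 * c - + 0 * b + a * a ≡ a * a + d * d
  generator-k-w = solve-∀
  generator-k-re-v : ∀ a b c d → a * a - + 0 * b - + 0 * c - (- d) * d ≡ a * a + d * d
  generator-k-re-v = solve-∀

axis-identity-i : ∀ g P →
  axialNorm i P • (g · P) ≡
    coordinate i (g · P) • (tracelessFactor i P · P) ⊕ re (g · P) • (realFactor i P · P)
      ⊕ sumOfSquares P • (orthogonalPart i g · axialPart i P)
axis-identity-i (q4 g₀ g₁ g₂ g₃) (q4 a b c d) =
  q4-ext (axis-i-re g₀ g₁ g₂ g₃ a b c d) (axis-i-i g₀ g₁ g₂ g₃ a b c d)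
         (axis-i-j g₀ g₁ g₂ g₃ a b c d) (axis-i-k g₀ g₁ g₂ g₃ a b c d)

axis-identity-j : ∀ g P →
  axialNorm j P • (g · P) ≡
    coordinate j (g · P) • (tracelessFactor j P · P) ⊕ re (g · P) • (realFactor j P · P)
      ⊕ sumOfSquares P • (orthogonalPart j g · axialPart j P)
axis-identity-j (q4 g₀ g₁ g₂ g₃) (q4 a b c d) =
  q4-ext (axis-j-re g₀ g₁ g₂ g₃ a b c d) (axis-j-i g₀ g₁ g₂ g₃ a b c d)
         (axis-j-j g₀ g₁ g₂ g₃ a b c d) (axis-j-k g₀ g₁ g₂ g₃ a b c d)

axis-identity-k : ∀ g P →
  axialNorm k P • (g · P) ≡
    coordinate k (g · P) • (tracelessFactor k P · P) ⊕ re (g · P) • (realFactor k P · P)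
      ⊕ sumOfSquares P • (orthogonalPart k g · axialPart k P)
axis-identity-k (q4 g₀ g₁ g₂ g₃) (q4 a b c d) =
  q4-ext (axis-k-re g₀ g₁ g₂ g₃ a b c d) (axis-k-i g₀ g₁ g₂ g₃ a b c d)
         (axis-k-j g₀ g₁ g₂ g₃ a b c d) (axis-k-k g₀ g₁ g₂ g₃ a b c d)

axis-identity : ∀ u g P →
  axialNorm u P • (g · P) ≡
    coordinate u (g · P) • (tracelessFactor u P · P) ⊕ re (g · P) • (realFactor u P · P)
      ⊕ sumOfSquares P • (orthogonalPart u g · axialPart u P)
axis-identity i = axis-identity-i
axis-identity j = axis-identity-j
axis-identity k = axis-identity-k

generator-coordinates : ∀ u P →
  (re (tracelessFactor u P · P) ≡ + 0) × (coordinate u (tracelessFactor u P · P) ≡ axialNorm u P) ×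
  (re (realFactor u P · P) ≡ axialNorm u P)
generator-coordinates i (q4 a b c d) =
  generator-i-re-w a b c d , generator-i-w a b c d , generator-i-re-v a b c d
generator-coordinates j (q4 a b c d) =
  generator-j-re-w a b c d , generator-j-w a b c d , generator-j-re-v a b c d
generator-coordinates k (q4 a b c d) =
  generator-k-re-w a b c d , generator-k-w a b c d , generator-k-re-v a b c d

≉0-by-coordinate : ∀ {m} u {x} → ¬ coordinate u x ≡ + 0 mod m → ¬ x ≈ zeroQ mod m
≉0-by-coordinate i x≢0 h = x≢0 (im-i-mod h)
≉0-by-coordinate j x≢0 h = x≢0 (im-j-mod h)
≉0-by-coordinate k x≢0 h = x≢0 (im-k-mod h)

module _ {p : ℕ} (p-prime : Prime p) (p-odd : ¬ 2 ∣ p) {P : Q4} (P-hurwitz : IsHurwitz P)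
         (N≡0 : sumOfSquares P ≡ + 0 mod p) (u : Axis) (n≢0 : ¬ axialNorm u P ≡ + 0 mod p) where

  private
    n = axialNorm u P
    w = tracelessFactor u P · P
    v = realFactor u P · P

    into-span : ∀ g → n • (g · P) ≈ coordinate u (g · P) • w ⊕ re (g · P) • v mod p
    into-span g = begin
      n • (g · P)                            ≡⟨ axis-identity u g P ⟩
      combination ⊕ sumOfSquares P • error   ≈⟨ ⊕-congˡ combination (•-zero-mod _ error N≡0) ⟩
      combination ⊕ zeroQ                    ≡⟨ ⊕-identityʳ combination ⟩
      combination                            ∎
      where
      open SetoidReasoning (Q4-mod p)
      combination = coordinate u (g · P) • w ⊕ re (g · P) • v
      error = orthogonalPart u g · axialPart u P

    4n≢0 : ¬ n * + 4 ≡ + 0 mod p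
    4n≢0 = mod-nonzero-* p-prime n≢0 (mod-nonzero-* p-prime 2≢0 2≢0)
      where
      2≢0 = 2≢0-mod p-prime p-odd

  left-ideal-spanned : Spans p (InΠ p P) w v
  left-ideal-spanned x = mk⇔ to-span from-span
    where
    to-span : InΠ p P x → Σ ℤ λ s → Σ ℤ λ t → x ≈[ p ] s • w ⊕ t • v
    to-span (h , h-hurwitz , 2x≈h⊗P) = c⁻¹ * coordinate u y , c⁻¹ * re y ,
      to-≈[] x ((c⁻¹ * coordinate u y) • w ⊕ (c⁻¹ * re y) • v) (begin
      x                                              ≈⟨ •-solve (n * + 4) c⁻¹ x c⁻¹c≡1 4nx≈ ⟩
      c⁻¹ • (coordinate u y • w ⊕ re y • v)
        ≡⟨ •-distrib-combination c⁻¹ (coordinate u y) (re y) w v ⟩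
      (c⁻¹ * coordinate u y) • w ⊕ (c⁻¹ * re y) • v  ∎)
      where
      open SetoidReasoning (Q4-mod p)
      y = h · P
      c⁻¹ = proj₁ (mod-inverse p-prime 4n≢0)
      c⁻¹c≡1 = proj₂ (mod-inverse p-prime 4n≢0)
      4nx≈ : (n * + 4) • x ≈ coordinate u y • w ⊕ re y • v mod p
      4nx≈ = begin
        (n * + 4) • x          ≡⟨ •-assoc n (+ 4) x ⟨
        n • (+ 4 • x)          ≡⟨ cong (n •_) (•-assoc (+ 2) (+ 2) x) ⟨
        n • (+ 2 • (+ 2 • x))  ≈⟨ •-congˡ n (•-congˡ (+ 2) (from-≈[] (+ 2 • x) (h ⊗ P) 2x≈h⊗P)) ⟩
        n • (+ 2 • (h ⊗ P))    ≡⟨ cong (n •_) (⊗-double h P h-hurwitz P-hurwitz) ⟩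
        n • y                  ≈⟨ into-span h ⟩
        coordinate u y • w ⊕ re y • v ∎
    from-span : (Σ ℤ λ s → Σ ℤ λ t → x ≈[ p ] s • w ⊕ t • v) → InΠ p P x
    from-span (s , t , x≈) = + 2 • (+ 2 • g) , double-isHurwitz (+ 2 • g) ,
      to-≈[] (+ 2 • x) ((+ 2 • (+ 2 • g)) ⊗ P) (begin
      + 2 • x                          ≈⟨ •-congˡ (+ 2) (from-≈[] x (s • w ⊕ t • v) x≈) ⟩
      + 2 • (s • w ⊕ t • v)            ≡⟨ cong (+ 2 •_) (·-linearˡ s t w₀ v₀ P) ⟨
      + 2 • (g · P)                    ≡⟨ ·-•-assocˡ (+ 2) g P ⟨
      (+ 2 • g) · P                    ≡⟨ half-double ((+ 2 • g) · P) ⟨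
      half (+ 2 • ((+ 2 • g) · P))     ≡⟨ cong half (·-•-assocˡ (+ 2) (+ 2 • g) P) ⟨
      (+ 2 • (+ 2 • g)) ⊗ P            ∎)
      where
      open SetoidReasoning (Q4-mod p)
      w₀ = tracelessFactor u P
      v₀ = realFactor u P
      g = s • w₀ ⊕ t • v₀

  left-ideal-plane : IsPlane p (InΠ p P) × HasUniqueTracelessLine p (InΠ p P)
  left-ideal-plane = plane-with-unique-traceless-line p-prime p-odd left-ideal-spanned
    (mod-reflexive re-w≡0)
    (≉0-by-coordinate u (λ h → n≢0 (mod-trans (mod-reflexive (sym w-coordinate≡n)) h)))
    (λ h → n≢0 (mod-trans (mod-reflexive (sym re-v≡n)) h))
    where
    re-w≡0 = proj₁ (generator-coordinates u P)
    w-coordinate≡n = proj₁ (proj₂ (generator-coordinates u P))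
    re-v≡n = proj₂ (proj₂ (generator-coordinates u P))

-- Some axis is nondegenerate

private
  sumOfSquares-multiples : ∀ a b c d q →
    a * q * (a * q) + b * q * (b * q) + c * q * (c * q) + d * q * (d * q) ≡
      (a * a + b * b + c * c + d * d) * q * q
  sumOfSquares-multiples = solve-∀

  twice-square : ∀ a b c d →
    + 2 * (a * a) ≡
      (a * a + b * b) + (a * a + c * c) + (a * a + d * d) + - + 1 * (a * a + b * b + c * c + d * d)
  twice-square = solve-∀

  other-square : ∀ a x → x * x ≡ (a * a + x * x) + - + 1 * (a * a)
  other-square = solve-∀

module _ {p : ℕ} (p-prime : Prime p) (p-odd : ¬ 2 ∣ p) where

  private
    2≢0 : ¬ + 2 ≡ + 0 mod p
    2≢0 = 2≢0-mod p-prime p-odd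

    multiple-of-p : ∀ {x} → x ≡ + 0 mod p → Σ ℤ λ x′ → x ≡ x′ * + p
    multiple-of-p {x} (lift-mod h) with ∣ᵤ⇒∣ h
    ... | divides x′ e = x′ , trans (sym (+-identityʳ x)) e

  p²∤4p : ∀ P → re P ≡ + 0 mod p → im-i P ≡ + 0 mod p → im-j P ≡ + 0 mod p → im-k P ≡ + 0 mod p →
          ¬ sumOfSquares P ≡ + p * + 4
  p²∤4p P a≡0 b≡0 c≡0 d≡0 N≡4p =
    mod-nonzero-* p-prime 2≢0 2≢0 (lift-mod (∣⇒∣ᵤ (divides S 4≡S*p)))
    where
    a′ = proj₁ (multiple-of-p a≡0)
    b′ = proj₁ (multiple-of-p b≡0)
    c′ = proj₁ (multiple-of-p c≡0)
    d′ = proj₁ (multiple-of-p d≡0)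
    S = sumOfSquares (q4 a′ b′ c′ d′)
    S*p*p≡4*p : S * + p * + p ≡ + 4 * + p
    S*p*p≡4*p = begin
      S * + p * + p                    ≡⟨ sumOfSquares-multiples a′ b′ c′ d′ (+ p) ⟨
      sumOfSquares (q4 (a′ * + p) (b′ * + p) (c′ * + p) (d′ * + p))
        ≡⟨ cong sumOfSquares (q4-cong (proj₂ (multiple-of-p a≡0)) (proj₂ (multiple-of-p b≡0))
                                      (proj₂ (multiple-of-p c≡0)) (proj₂ (multiple-of-p d≡0))) ⟨
      sumOfSquares P                   ≡⟨ N≡4p ⟩
      + p * + 4                        ≡⟨ *-comm (+ p) (+ 4) ⟩
      + 4 * + p                        ∎
      where open ≡-Reasoning
    4≡S*p : + 4 ≡ S * + p
    4≡S*p = sym (*-cancelʳ-≡ (S * + p) (+ 4) (+ p) {{prime⇒nonZero p-prime}} S*p*p≡4*p)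

  coordinates-vanish : ∀ P → sumOfSquares P ≡ + 0 mod p →
    axialNorm i P ≡ + 0 mod p → axialNorm j P ≡ + 0 mod p → axialNorm k P ≡ + 0 mod p →
    (re P ≡ + 0 mod p) × (im-i P ≡ + 0 mod p) × (im-j P ≡ + 0 mod p) × (im-k P ≡ + 0 mod p)
  coordinates-vanish P N≡0 nᵢ≡0 nⱼ≡0 nₖ≡0 =
    a≡0 , other-coordinate nᵢ≡0 , other-coordinate nⱼ≡0 , other-coordinate nₖ≡0
    where
    open SetoidReasoning (ℤ-mod p)
    a = re P
    a≡0 : a ≡ + 0 mod p
    a≡0 = mod-square p-prime (mod-zero-productˡ p-prime 2≢0 (begin
      + 2 * (a * a)   ≡⟨ twice-square a (im-i P) (im-j P) (im-k P) ⟩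
      _               ≈⟨ +-cong-mod (+-cong-mod (+-cong-mod nᵢ≡0 nⱼ≡0) nₖ≡0) (*-congˡ-mod (- + 1) N≡0) ⟩
      + 0             ∎))
    other-coordinate : ∀ {x} → a * a + x * x ≡ + 0 mod p → x ≡ + 0 mod p
    other-coordinate {x} n≡0 = mod-square p-prime (begin
      x * x   ≡⟨ other-square a x ⟩
      _       ≈⟨ +-cong-mod n≡0 (*-congˡ-mod (- + 1) (*-cong-mod a≡0 a≡0)) ⟩
      + 0     ∎)

  ¬all-axes-degenerate : ∀ P → sumOfSquares P ≡ + p * + 4 →
    ¬ ((axialNorm i P ≡ + 0 mod p) × (axialNorm j P ≡ + 0 mod p) × (axialNorm k P ≡ + 0 mod p))
  ¬all-axes-degenerate P N≡4p (nᵢ≡0 , nⱼ≡0 , nₖ≡0) = p²∤4p P a≡0 b≡0 c≡0 d≡0 N≡4p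
    where
    vanish = coordinates-vanish P (mod-trans (mod-reflexive N≡4p) (multiple-mod (+ 4))) nᵢ≡0 nⱼ≡0 nₖ≡0
    a≡0 = proj₁ vanish
    b≡0 = proj₁ (proj₂ vanish)
    c≡0 = proj₁ (proj₂ (proj₂ vanish))
    d≡0 = proj₂ (proj₂ (proj₂ vanish))

  nondegenerate-axis : ∀ P → sumOfSquares P ≡ + p * + 4 → Σ Axis λ u → ¬ axialNorm u P ≡ + 0 mod p
  nondegenerate-axis P N≡4p
    with mod? (axialNorm i P) (+ 0) | mod? (axialNorm j P) (+ 0) | mod? (axialNorm k P) (+ 0)
  ... | no nᵢ≢0 | _         | _         = i , nᵢ≢0
  ... | yes _   | no nⱼ≢0   | _         = j , nⱼ≢0
  ... | yes _   | yes _     | no nₖ≢0   = k , nₖ≢0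
  ... | yes nᵢ≡0 | yes nⱼ≡0 | yes nₖ≡0 = ⊥-elim (¬all-axes-degenerate P N≡4p (nᵢ≡0 , nⱼ≡0 , nₖ≡0))

lemma2p1 : (p : ℕ) → Prime p → ¬ (2 ∣ p) →
    (P : Q4) → IsHurwitz P → IsHurwitzPrime P → normH P ≡ + p →
    -- Π is a two-dimensional 𝔽_p-subspace: Π = span(u, v) with u, v independent
    (Σ Q4 λ u → Σ Q4 λ v →
      (∀ x → InΠ p P x ⇔ (Σ ℤ λ s → Σ ℤ λ t → x ≈[ p ] ((s • u) ⊕ (t • v)))) ×
      (∀ s t → ((s • u) ⊕ (t • v)) ≈[ p ] zeroQ → (s ≡[ p ] + 0) × (t ≡[ p ] + 0)))
    ×
    -- there is a nonzero trace-zero element of Π, unique up to 𝔽_p^× scaling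
    (Σ Q4 λ w → InΠ p P w × ¬ (w ≈[ p ] zeroQ) × (tr w ≡[ p ] + 0) ×
      (∀ w' → InΠ p P w' → ¬ (w' ≈[ p ] zeroQ) → tr w' ≡[ p ] + 0 →
        Σ ℤ λ c → ¬ (c ≡[ p ] + 0) × (w' ≈[ p ] (c • w))))
lemma2p1 p p-prime p-odd P P-hurwitz _ normP≡p =
  left-ideal-plane p-prime p-odd P-hurwitz N≡0 (proj₁ axis) (proj₂ axis)
  where
  N≡4p : sumOfSquares P ≡ + p * + 4
  N≡4p = trans (hurwitz-sumOfSquares P P-hurwitz) (cong (_* + 4) normP≡p)
  N≡0 : sumOfSquares P ≡ + 0 mod p
  N≡0 = mod-trans (mod-reflexive N≡4p) (multiple-mod (+ 4))
  axis : Σ Axis λ u → ¬ axialNorm u P ≡ + 0 mod p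
  axis = nondegenerate-axis p-prime p-odd P N≡4p
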